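{- Let $H\colon \prod_i \mathcal{C}_i \to \mathcal{D}$ be a functor and let $\mathbb{C}_1,\dots,\mathbb{C}_n$ and $\mathbb{D}$ be comonads on categories $\mathcal{C}_1,\dots,\mathcal{C}_n$ and $\mathcal{D}$, respectively, such that each of the arising Eilenberg--Moore categories of coalgebras $\mathrm{EM}(\mathbb{C}_1),\dots,\mathrm{EM}(\mathbb{C}_n),\mathrm{EM}(\mathbb{D})$ is a path category and, furthermore, $\mathrm{EM}(\mathbb{D})$ has equalisers. If $H$ preserves embeddings and there exists a Kleisli law $\kappa$ of type $\mathbb{D}\circ H \Rightarrow H \circ \prod_i\mathbb{C}_i$ satisfying axiom (S2') (stated in the context), then \[ A_1 \equiv_{\mathbb{C}_1} B_1, \;\ldots,\; A_n \equiv_{\mathbb{C}_n} B_n \] implies \[ H(A_1,\dots,A_n) \;\equiv_{\mathbb{D}}\; H(B_1,\dots,B_n). \]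
   Context: A path category is a category equipped with a proper factorisation system $(\mathcal{E},\mathcal{M})$ (morphisms in $\mathcal{E}$ are called quotients and are epimorphisms; morphisms in $\mathcal{M}$ are called embeddings and are monomorphisms) together with a chosen class of path objects. In the setting considered, the base categories $\mathcal{C}_i,\mathcal{D}$ carry proper factorisation systems, the comonads preserve embeddings, and the factorisation system on a category of coalgebras is lifted from the base: a coalgebra morphism is a quotient (resp. embedding) iff its underlying morphism is a quotient (resp. embedding) in the base category. $H$ preserves embeddings means $H(f_1,\dots,f_n)$ is an embedding whenever each $f_i$ is. In a path category, a path embedding is an embedding $e\colon P\rightarrowtail X$ with $P$ a path. A morphism $f\colon X\to Y$ is a pathwise-embedding if $f\circ e$ is an embedding for every path embedding $e\colon P\rightarrowtail X$. It is open if for every commutative square $f\circ e = m\circ g$ with $e\colon P\rightarrowtail X$, $g\colon P\rightarrowtail Q$, $m\colon Q\rightarrowtail Y$ path embeddings, there is $d\colon Q\to X$ with $e=d\circ g$ and $m=f\circ d$. For a comonad $\mathbb{C}$ (with counit $\varepsilon$ and comultiplication $\delta$), a coalgebra $(A,\alpha)$ is a morphism $\alpha\colon A\to\mathbb{C}(A)$ with $\varepsilon_A\circ\alpha=\mathrm{id}$ and $\delta_A\circ\alpha=\mathbb{C}(\alpha)\circ\alpha$; the cofree coalgebra on $A$ is $F^{\mathbb{C}}(A)=(\mathbb{C}(A),\delta_A)$. For objects $A,B$, $A\equiv_{\mathbb{C}} B$ means there exists a span $F^{\mathbb{C}}(A)\leftarrow Z\rightarrow F^{\mathbb{C}}(B)$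 of open pathwise-embeddings in $\mathrm{EM}(\mathbb{C})$. A Kleisli law is a natural transformation $\kappa\colon \mathbb{D}\circ H\Rightarrow H\circ\prod_i\mathbb{C}_i$ such that (K1) $H(\prod_i\varepsilon)\circ\kappa=\varepsilon_H$ and (K2) $H(\prod_i\delta)\circ\kappa=\kappa_{\prod_i \mathbb{C}_i}\circ\mathbb{D}\kappa\circ\delta_H$. Given $\kappa$, a bimorphism from a $\mathbb{D}$-coalgebra $(A,\alpha)$ to $\mathbb{C}_i$-coalgebras $(B_i,\beta_i)$, written $\alpha\to[\beta_1,\dots,\beta_n]$, is a morphism $g\colon A\to H(B_1,\dots,B_n)$ in $\mathcal{D}$ with $H(\beta_1,\dots,\beta_n)\circ g=\kappa\circ\mathbb{D}(g)\circ\alpha$. Axiom (S2'): for any path $(P,\pi)$ in $\mathrm{EM}(\mathbb{D})$ and coalgebras $(A_i,\alpha_i)$ in $\mathrm{EM}(\mathbb{C}_i)$, $1\le i\le n$, every bimorphism $f\colon\pi\to[\alpha_1,\dots,\alpha_n]$ has a minimal decomposition as $f=H(e_1,\dots,e_n)\circ f_0$ with $f_0\colon P\to H(P_1,\dots,P_n)$ and path embeddings $e_i\colon(P_i,\pi_i)\rightarrowtail(A_i,\alpha_i)$; minimality means that for any other such decomposition $f=H(g_1,\dots,g_n)\circ g_0$ with path embeddings $g_i\colon(Q_i,\rho_i)\rightarrowtail(A_i,\alpha_i)$ there exist morphisms $h_i\colon P_i\to Q_i$ with $e_i=g_i\circ h_i$ for all $i$. -}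

module Defs where

open import Level using (Level; _⊔_; suc)
open import Data.Nat using (ℕ)
open import Data.Fin using (Fin)
open import Data.Product using (Σ; Σ-syntax; _×_; _,_)
open import Relation.Binary using (Rel; IsEquivalence; Setoid)
import Relation.Binary.Reasoning.Setoid as SetoidR

record Category (o ℓ e : Level) : Set (suc (o ⊔ ℓ ⊔ e)) where
  infixr 9 _∘_
  infix 4 _≈_
  field
    Obj : Set o
    _⇒_ : Obj → Obj → Set ℓ
    _≈_ : ∀ {A B} → Rel (A ⇒ B) e
    id : ∀ {A} → A ⇒ A
    _∘_ : ∀ {A B C} → B ⇒ C → A ⇒ B → A ⇒ C
    equiv : ∀ {A B} → IsEquivalence (_≈_ {A} {B})
    ∘-resp-≈ : ∀ {A B C} {f h : B ⇒ C} {g i : A ⇒ B} →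
               f ≈ h → g ≈ i → f ∘ g ≈ h ∘ i
    assoc : ∀ {A B C D} {f : A ⇒ B} {g : B ⇒ C} {h : C ⇒ D} →
            (h ∘ g) ∘ f ≈ h ∘ (g ∘ f)
    identityˡ : ∀ {A B} {f : A ⇒ B} → id ∘ f ≈ f
    identityʳ : ∀ {A B} {f : A ⇒ B} → f ∘ id ≈ f

  hom-setoid : Obj → Obj → Setoid ℓ e
  hom-setoid A B = record { Carrier = A ⇒ B ; _≈_ = _≈_ ; isEquivalence = equiv }

  module Equiv {A B : Obj} = IsEquivalence (equiv {A} {B})

record Functor {o ℓ e : Level} (C D : Category o ℓ e) : Set (o ⊔ ℓ ⊔ e) where
  private
    module C = Category C
    module D = Category D
  field
    F₀ : C.Obj → D.Obj
    F₁ : ∀ {A B} → A C.⇒ B → F₀ A D.⇒ F₀ B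
    identity : ∀ {A} → F₁ (C.id {A}) D.≈ D.id
    homomorphism : ∀ {A B C'} {f : A C.⇒ B} {g : B C.⇒ C'} →
                   F₁ (g C.∘ f) D.≈ F₁ g D.∘ F₁ f
    F-resp-≈ : ∀ {A B} {f g : A C.⇒ B} → f C.≈ g → F₁ f D.≈ F₁ g

Πᶜ : ∀ {o ℓ e} {n : ℕ} → (Fin n → Category o ℓ e) → Category o ℓ e
Πᶜ {n = n} C = record
  { Obj = (i : Fin n) → Category.Obj (C i)
  ; _⇒_ = λ A B → (i : Fin n) → Category._⇒_ (C i) (A i) (B i)
  ; _≈_ = λ f g → (i : Fin n) → Category._≈_ (C i) (f i) (g i)
  ; id = λ i → Category.id (C i)
  ; _∘_ = λ g f i → Category._∘_ (C i) (g i) (f i)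
  ; equiv = record
      { refl = λ i → Category.Equiv.refl (C i)
      ; sym = λ p i → Category.Equiv.sym (C i) (p i)
      ; trans = λ p q i → Category.Equiv.trans (C i) (p i) (q i) }
  ; ∘-resp-≈ = λ p q i → Category.∘-resp-≈ (C i) (p i) (q i)
  ; assoc = λ i → Category.assoc (C i)
  ; identityˡ = λ i → Category.identityˡ (C i)
  ; identityʳ = λ i → Category.identityʳ (C i)
  }

record Comonad {o ℓ e : Level} (C : Category o ℓ e) : Set (o ⊔ ℓ ⊔ e) where
  open Category C
  field
    W : Functor C C
  open Functor W public renaming (F₀ to W₀; F₁ to W₁)
  field
    ε : ∀ A → W₀ A ⇒ A
    δ : ∀ A → W₀ A ⇒ W₀ (W₀ A)
    ε-natural : ∀ {A B} (f : A ⇒ B) → ε B ∘ W₁ f ≈ f ∘ ε A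
    δ-natural : ∀ {A B} (f : A ⇒ B) → δ B ∘ W₁ f ≈ W₁ (W₁ f) ∘ δ A
    identityˡ-law : ∀ A → ε (W₀ A) ∘ δ A ≈ id
    identityʳ-law : ∀ A → W₁ (ε A) ∘ δ A ≈ id
    assoc-law : ∀ A → δ (W₀ A) ∘ δ A ≈ W₁ (δ A) ∘ δ A

module _ {o ℓ e : Level} {C : Category o ℓ e} (K : Comonad C) where
  open Category C
  open Comonad K

  record Coalgebra : Set (o ⊔ ℓ ⊔ e) where
    field
      carrier : Obj
      α : carrier ⇒ W₀ carrier
      counit : ε carrier ∘ α ≈ id
      coassoc : δ carrier ∘ α ≈ W₁ α ∘ α

  record CoalgHom (X Y : Coalgebra) : Set (ℓ ⊔ e) where
    private
      module X = Coalgebra X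
      module Y = Coalgebra Y
    field
      hom : X.carrier ⇒ Y.carrier
      comm : W₁ hom ∘ X.α ≈ Y.α ∘ hom

  open Coalgebra
  open CoalgHom

  EM : Category (o ⊔ ℓ ⊔ e) (ℓ ⊔ e) e
  EM = record
    { Obj = Coalgebra
    ; _⇒_ = CoalgHom
    ; _≈_ = λ f g → hom f ≈ hom g
    ; id = λ {X} → record
        { hom = id
        ; comm = trans (∘-resp-≈ identity refl)
                  (trans identityˡ (sym identityʳ)) }
    ; _∘_ = λ {X} {Y} {Z} g f → record { hom = hom g ∘ hom f ; comm = comp-comm X Y Z g f }
    ; equiv = record { refl = refl ; sym = sym ; trans = trans }
    ; ∘-resp-≈ = ∘-resp-≈
    ; assoc = assoc
    ; identityˡ = identityˡ
    ; identityʳ = identityʳ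
    }
    where
    open Equiv
    comp-comm : ∀ X Y Z (g : CoalgHom Y Z) (f : CoalgHom X Y) →
                W₁ (hom g ∘ hom f) ∘ α X ≈ α Z ∘ (hom g ∘ hom f)
    comp-comm X Y Z g f = begin
        W₁ (hom g ∘ hom f) ∘ α X      ≈⟨ ∘-resp-≈ homomorphism refl ⟩
        (W₁ (hom g) ∘ W₁ (hom f)) ∘ α X ≈⟨ assoc ⟩
        W₁ (hom g) ∘ (W₁ (hom f) ∘ α X) ≈⟨ ∘-resp-≈ refl (comm f) ⟩
        W₁ (hom g) ∘ (α Y ∘ hom f)    ≈⟨ sym assoc ⟩
        (W₁ (hom g) ∘ α Y) ∘ hom f    ≈⟨ ∘-resp-≈ (comm g) refl ⟩
        (α Z ∘ hom g) ∘ hom f         ≈⟨ assoc ⟩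
        α Z ∘ (hom g ∘ hom f)         ∎
      where open SetoidR (hom-setoid _ _)

  cofree : Obj → Coalgebra
  cofree A = record
    { carrier = W₀ A ; α = δ A ; counit = identityˡ-law A ; coassoc = assoc-law A }

module _ {o ℓ e : Level} (K : Category o ℓ e) where
  open Category K

  IsIso : ∀ {A B} → A ⇒ B → Set (ℓ ⊔ e)
  IsIso {A} {B} f = Σ[ g ∈ B ⇒ A ] ((g ∘ f ≈ id) × (f ∘ g ≈ id))

  MorphismClass : (p : Level) → Set (o ⊔ ℓ ⊔ suc p)
  MorphismClass p = ∀ {A B} → A ⇒ B → Set p

  record IsProperFactorisationSystem {p : Level} (E M : MorphismClass p)
         : Set (o ⊔ ℓ ⊔ e ⊔ p) where
    field
      E-resp-≈ : ∀ {A B} {f g : A ⇒ B} → f ≈ g → E f → E g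
      M-resp-≈ : ∀ {A B} {f g : A ⇒ B} → f ≈ g → M f → M g
      E-iso : ∀ {A B} {f : A ⇒ B} → IsIso f → E f
      M-iso : ∀ {A B} {f : A ⇒ B} → IsIso f → M f
      E-comp : ∀ {A B C} {f : A ⇒ B} {g : B ⇒ C} → E f → E g → E (g ∘ f)
      M-comp : ∀ {A B C} {f : A ⇒ B} {g : B ⇒ C} → M f → M g → M (g ∘ f)
      factor : ∀ {A B} (f : A ⇒ B) →
               Σ[ C ∈ Obj ] Σ[ q ∈ A ⇒ C ] Σ[ m ∈ C ⇒ B ] (E q × M m × f ≈ m ∘ q)
      diagonal : ∀ {A B C D} {q : A ⇒ B} {m : C ⇒ D} {u : A ⇒ C} {v : B ⇒ D} →
                 E q → M m → m ∘ u ≈ v ∘ q →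
                 Σ[ d ∈ B ⇒ C ] ((d ∘ q ≈ u) × (m ∘ d ≈ v))
      diagonal-unique : ∀ {A B C D} {q : A ⇒ B} {m : C ⇒ D} {u : A ⇒ C} {v : B ⇒ D} →
                 E q → M m → (d d′ : B ⇒ C) →
                 d ∘ q ≈ u → m ∘ d ≈ v → d′ ∘ q ≈ u → m ∘ d′ ≈ v → d ≈ d′
      E-epi : ∀ {A B C} {q : A ⇒ B} → E q → (g h : B ⇒ C) → g ∘ q ≈ h ∘ q → g ≈ h
      M-mono : ∀ {A B C} {m : B ⇒ C} → M m → (g h : A ⇒ B) → m ∘ g ≈ m ∘ h → g ≈ h

  record FactorisationSystem (p : Level) : Set (o ⊔ ℓ ⊔ e ⊔ suc p) where
    field
      Quot : MorphismClass p
      Emb  : MorphismClass p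
      isProperFactorisationSystem : IsProperFactorisationSystem Quot Emb

  record Equaliser {A B : Obj} (f g : A ⇒ B) : Set (o ⊔ ℓ ⊔ e) where
    field
      obj : Obj
      arr : obj ⇒ A
      equality : f ∘ arr ≈ g ∘ arr
      universal : ∀ {X} (h : X ⇒ A) → f ∘ h ≈ g ∘ h → Σ[ u ∈ X ⇒ obj ] (arr ∘ u ≈ h)
      unique : ∀ {X} (h : X ⇒ A) (u v : X ⇒ obj) → arr ∘ u ≈ h → arr ∘ v ≈ h → u ≈ v

  HasEqualisers : Set (o ⊔ ℓ ⊔ e)
  HasEqualisers = ∀ {A B} (f g : A ⇒ B) → Equaliser f g

module _ {o ℓ e p : Level} {C : Category o ℓ e} where
  open Category C

  PreservesEmbeddings : FactorisationSystem C p → Comonad C → Set (o ⊔ ℓ ⊔ p)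
  PreservesEmbeddings FS K =
    ∀ {A B} (f : A ⇒ B) → FactorisationSystem.Emb FS f →
      FactorisationSystem.Emb FS (Comonad.W₁ K f)

  module _ (K : Comonad C) (FS : FactorisationSystem C p) where
    LiftQuot : MorphismClass (EM K) p
    LiftQuot f = FactorisationSystem.Quot FS (CoalgHom.hom f)

    LiftEmb : MorphismClass (EM K) p
    LiftEmb f = FactorisationSystem.Emb FS (CoalgHom.hom f)

    -- EM(K) is a path category: the lifted classes form a proper
    -- factorisation system on EM(K), together with a chosen class of paths.
    record EMPathCategory : Set (o ⊔ ℓ ⊔ e ⊔ suc p) where
      field
        liftedIsProper : IsProperFactorisationSystem (EM K) LiftQuot LiftEmb
        IsPath : Coalgebra K → Set p

module _ {o ℓ e p : Level} {C : Category o ℓ e} {K : Comonad C}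
         {FS : FactorisationSystem C p} (PC : EMPathCategory K FS) where
  open Category (EM K)
  open EMPathCategory PC

  IsPathEmbedding : ∀ {P X} → P ⇒ X → Set p
  IsPathEmbedding {P} e = IsPath P × LiftEmb K FS e

  IsPathwiseEmbedding : ∀ {X Y} → X ⇒ Y → Set (o ⊔ ℓ ⊔ e ⊔ p)
  IsPathwiseEmbedding {X} f =
    ∀ {P} (e : P ⇒ X) → IsPathEmbedding e → LiftEmb K FS (f ∘ e)

  IsOpen : ∀ {X Y} → X ⇒ Y → Set (o ⊔ ℓ ⊔ e ⊔ p)
  IsOpen {X} {Y} f =
    ∀ {P Q} (e : P ⇒ X) (g : P ⇒ Q) (m : Q ⇒ Y) →
    IsPathEmbedding e → IsPathEmbedding g → IsPathEmbedding m →
    f ∘ e ≈ m ∘ g →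
    Σ[ d ∈ Q ⇒ X ] ((e ≈ d ∘ g) × (m ≈ f ∘ d))

  IsOpenPathwiseEmbedding : ∀ {X Y} → X ⇒ Y → Set (o ⊔ ℓ ⊔ e ⊔ p)
  IsOpenPathwiseEmbedding f = IsOpen f × IsPathwiseEmbedding f

  _≡ₖ_ : Category.Obj C → Category.Obj C → Set (o ⊔ ℓ ⊔ e ⊔ p)
  A ≡ₖ B = Σ[ Z ∈ Obj ] Σ[ s ∈ Z ⇒ cofree K A ] Σ[ t ∈ Z ⇒ cofree K B ]
           (IsOpenPathwiseEmbedding s × IsOpenPathwiseEmbedding t)

module _ {o ℓ e p : Level} {n : ℕ} {C : Fin n → Category o ℓ e} {D : Category o ℓ e}
         (H : Functor (Πᶜ C) D) where
  private
    module D = Category D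
    module C (i : Fin n) = Category (C i)
  open Functor H

  HPreservesEmbeddings : (∀ i → FactorisationSystem (C i) p) → FactorisationSystem D p →
                         Set (o ⊔ ℓ ⊔ p)
  HPreservesEmbeddings FC FD =
    ∀ {X Y : Category.Obj (Πᶜ C)} (f : Category._⇒_ (Πᶜ C) X Y) →
    (∀ i → FactorisationSystem.Emb (FC i) (f i)) → FactorisationSystem.Emb FD (F₁ f)

  module _ (W : ∀ i → Comonad (C i)) (V : Comonad D) where
    private
      module W (i : Fin n) = Comonad (W i)
      module V = Comonad V

    record KleisliLaw : Set (o ⊔ ℓ ⊔ e) where
      field
        κ : ∀ (X : Category.Obj (Πᶜ C)) →
            V.W₀ (F₀ X) D.⇒ F₀ (λ i → W.W₀ i (X i))
        natural : ∀ {X Y} (f : Category._⇒_ (Πᶜ C) X Y) →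
            κ Y D.∘ V.W₁ (F₁ f) D.≈ F₁ (λ i → W.W₁ i (f i)) D.∘ κ X
        K1 : ∀ X → F₁ (λ i → W.ε i (X i)) D.∘ κ X D.≈ V.ε (F₀ X)
        K2 : ∀ X → F₁ (λ i → W.δ i (X i)) D.∘ κ X D.≈
                   κ (λ i → W.W₀ i (X i)) D.∘ (V.W₁ (κ X) D.∘ V.δ (F₀ X))

    module _ (KL : KleisliLaw) where
      open KleisliLaw KL

      carriers : (∀ i → Coalgebra (W i)) → Category.Obj (Πᶜ C)
      carriers B i = Coalgebra.carrier (B i)

      IsBimorphism : (A : Coalgebra V) (B : ∀ i → Coalgebra (W i)) →
                     Coalgebra.carrier A D.⇒ F₀ (carriers B) → Set e
      IsBimorphism A B g =
        F₁ (λ i → Coalgebra.α (B i)) D.∘ g D.≈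
        κ (carriers B) D.∘ (V.W₁ g D.∘ Coalgebra.α A)

      module _ (FC : ∀ i → FactorisationSystem (C i) p)
               (PC : ∀ i → EMPathCategory (W i) (FC i)) where

        record Decomposition (P : Coalgebra V) (A : ∀ i → Coalgebra (W i))
               (f : Coalgebra.carrier P D.⇒ F₀ (carriers A))
               : Set (o ⊔ ℓ ⊔ e ⊔ p) where
          field
            Pᵢ : ∀ i → Coalgebra (W i)
            emb : ∀ i → CoalgHom (W i) (Pᵢ i) (A i)
            emb-isPathEmbedding : ∀ i → IsPathEmbedding (PC i) (emb i)
            f₀ : Coalgebra.carrier P D.⇒ F₀ (carriers Pᵢ)
            factorisation : f D.≈ F₁ (λ i → CoalgHom.hom (emb i)) D.∘ f₀

        IsMinimalDecomposition : ∀ {P A f} → Decomposition P A f → Set (o ⊔ ℓ ⊔ e ⊔ p)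
        IsMinimalDecomposition {P} {A} {f} d =
          ∀ (d′ : Decomposition P A f) →
          Σ[ h ∈ (∀ i → CoalgHom (W i) (Decomposition.Pᵢ d i) (Decomposition.Pᵢ d′ i)) ]
          (∀ i → Category._≈_ (EM (W i)) (Decomposition.emb d i)
                   (Category._∘_ (EM (W i)) (Decomposition.emb d′ i) (h i)))

        AxiomS2′ : (FD : FactorisationSystem D p) → EMPathCategory V FD → Set (o ⊔ ℓ ⊔ e ⊔ p)
        AxiomS2′ FD PD =
          ∀ (P : Coalgebra V) → EMPathCategory.IsPath PD P →
          ∀ (A : ∀ i → Coalgebra (W i)) (f : Coalgebra.carrier P D.⇒ F₀ (carriers A)) →
          IsBimorphism P A f →
          Σ[ d ∈ Decomposition P A f ] IsMinimalDecomposition d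

{-# OPTIONS --safe #-}
-- Bimorphisms P → [Z] into a family Z of coalgebras are classified by a coalgebra K(Z): the
-- equaliser in EM(𝔻) of the transposes F(H Z) ⇉ F(H(ℂ Z)) of H(α_Z) ∘ ε and κ_Z, the two sides
-- of the bimorphism condition; let π be its universal bimorphism.  Given spans
-- F(Aᵢ) ← Zᵢ → F(Bᵢ) of open pathwise embeddings sᵢ, tᵢ, the span F(H A) ← K(Z) → F(H B)
-- consists of the transposes of H(ε ∘ s) ∘ π and H(ε ∘ t) ∘ π.  By (S2'), a path embedding
-- into K(Z) is a bimorphism factoring through path embeddings Pᵢ ↣ Zᵢ; the pathwise embeddings
-- sᵢ keep these embeddings and H and 𝔻 preserve embeddings, so the induced map is a pathwise
-- embedding.  For openness, a square against a path in F(H A) yields two decompositions of one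
-- bimorphism; comparing both with the minimal one gives, for each i, a square in EM(ℂᵢ) which
-- the openness of sᵢ fills, and the fillers assemble to a bimorphism whose classifying map is
-- the required diagonal.
module Submission where

open import Defs
open import Level using (Level; _⊔_)
open import Data.Nat using (ℕ)
open import Data.Fin using (Fin)
open import Data.Product using (Σ-syntax; _×_; _,_; proj₁; proj₂)
import Relation.Binary.Reasoning.Setoid as SetoidReasoning

module CategoryReasoning {o ℓ e : Level} (K : Category o ℓ e) where
  open Category K
  open Equiv public

  module HomReasoning {A B : Obj} = SetoidReasoning (hom-setoid A B)

  ∘-resp-≈ˡ : ∀ {A B C} {f h : B ⇒ C} {g : A ⇒ B} → f ≈ h → f ∘ g ≈ h ∘ g
  ∘-resp-≈ˡ f≈h = ∘-resp-≈ f≈h refl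

  ∘-resp-≈ʳ : ∀ {A B C} {f : B ⇒ C} {g h : A ⇒ B} → g ≈ h → f ∘ g ≈ f ∘ h
  ∘-resp-≈ʳ g≈h = ∘-resp-≈ refl g≈h

module FactorisationProperties {o ℓ e p : Level} (K : Category o ℓ e)
  {E M : MorphismClass K p} (PF : IsProperFactorisationSystem K E M) where
  open Category K
  open IsProperFactorisationSystem PF
  open CategoryReasoning K
  open HomReasoning

  retractable-quotient-isIso : ∀ {A B} {q : A ⇒ B} {r : B ⇒ A} →
                               E q → r ∘ q ≈ id → IsIso K q
  retractable-quotient-isIso {q = q} {r} q∈E rq≈id = r , rq≈id , qr≈id
    where
    qr≈id : q ∘ r ≈ id
    qr≈id = E-epi q∈E (q ∘ r) id (begin
      (q ∘ r) ∘ q  ≈⟨ assoc ⟩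
      q ∘ (r ∘ q)  ≈⟨ ∘-resp-≈ʳ rq≈id ⟩
      q ∘ id       ≈⟨ identityʳ ⟩
      q            ≈⟨ identityˡ ⟨
      id ∘ q       ∎)

  M-if-retractable-quotient : ∀ {A B C} {f : A ⇒ B} {q : A ⇒ C} {m : C ⇒ B} {r : C ⇒ A} →
                              E q → M m → f ≈ m ∘ q → r ∘ q ≈ id → M f
  M-if-retractable-quotient q∈E m∈M f≈mq rq≈id =
    M-resp-≈ (sym f≈mq) (M-comp (M-iso (retractable-quotient-isIso q∈E rq≈id)) m∈M)

  M-cancel : ∀ {A B C} {f : A ⇒ B} {g : B ⇒ C} → M (g ∘ f) → M f
  M-cancel {f = f} {g} gf∈M with factor f
  ... | _ , q , m , q∈E , m∈M , f≈mq =
    let (_ , dq≈id , _) = diagonal q∈E gf∈M square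
    in M-if-retractable-quotient q∈E m∈M f≈mq dq≈id
    where
    square : (g ∘ f) ∘ id ≈ (g ∘ m) ∘ q
    square = begin
      (g ∘ f) ∘ id  ≈⟨ identityʳ ⟩
      g ∘ f         ≈⟨ ∘-resp-≈ʳ f≈mq ⟩
      g ∘ (m ∘ q)   ≈⟨ assoc ⟨
      (g ∘ m) ∘ q   ∎

  equaliser-M : ∀ {A B} {f g : A ⇒ B} (Eq : Equaliser K f g) → M (Equaliser.arr Eq)
  equaliser-M {f = f} {g} Eq with factor (Equaliser.arr Eq)
  ... | _ , q , m , q∈E , m∈M , arr≈mq =
    let (k , arr∘k≈m) = universal m m-equalises
    in M-if-retractable-quotient q∈E m∈M arr≈mq (kq≈id k arr∘k≈m)
    where
    open Equaliser Eq
    m-equalises : f ∘ m ≈ g ∘ m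
    m-equalises = E-epi q∈E (f ∘ m) (g ∘ m) (begin
      (f ∘ m) ∘ q  ≈⟨ assoc ⟩
      f ∘ (m ∘ q)  ≈⟨ ∘-resp-≈ʳ arr≈mq ⟨
      f ∘ arr      ≈⟨ equality ⟩
      g ∘ arr      ≈⟨ ∘-resp-≈ʳ arr≈mq ⟩
      g ∘ (m ∘ q)  ≈⟨ assoc ⟨
      (g ∘ m) ∘ q  ∎)
    kq≈id : ∀ k → arr ∘ k ≈ m → k ∘ q ≈ id
    kq≈id k arr∘k≈m = unique arr (k ∘ q) id
      (begin
        arr ∘ (k ∘ q)  ≈⟨ assoc ⟨
        (arr ∘ k) ∘ q  ≈⟨ ∘-resp-≈ˡ arr∘k≈m ⟩
        m ∘ q          ≈⟨ arr≈mq ⟨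
        arr            ∎)
      identityʳ

module PathEmbeddingProperties {o ℓ e p : Level} {C : Category o ℓ e} {K : Comonad C}
  {FS : FactorisationSystem C p} (PC : EMPathCategory K FS) where
  open Category (EM K)
  open EMPathCategory PC
  open IsProperFactorisationSystem liftedIsProper
  open FactorisationProperties (EM K) liftedIsProper
  private
    module C = CategoryReasoning C

  IsPathEmbedding-cancel : ∀ {P X Y} {f : P ⇒ X} {g : X ⇒ Y} {h : P ⇒ Y} →
                           IsPathEmbedding PC h → h ≈ g ∘ f → IsPathEmbedding PC f
  IsPathEmbedding-cancel {f = f} {g} {h} (P-isPath , h∈M) h≈gf =
    P-isPath , M-cancel {f = f} {g} (M-resp-≈ {f = h} {g = g ∘ f} h≈gf h∈M)

  IsOpen-diagonal : ∀ {R A B X Y} {s : X ⇒ Y} {a : A ⇒ X} {b : B ⇒ Y}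
                      {h : R ⇒ A} {h′ : R ⇒ B} {m : R ⇒ Y} →
                    IsOpen PC s → IsPathEmbedding PC m → IsPathEmbedding PC b →
                    m ≈ (s ∘ a) ∘ h → m ≈ b ∘ h′ →
                    Σ[ r ∈ B ⇒ X ] ((a ∘ h ≈ r ∘ h′) × (b ≈ s ∘ r))
  IsOpen-diagonal {s = s} {a} {b} {h} {h′} {m} s-isOpen m-isPE b-isPE m≈sah m≈bh′ =
    s-isOpen (a ∘ h) h′ b
      (IsPathEmbedding-cancel {f = a ∘ h} {s} {m} m-isPE (C.trans m≈sah (Category.assoc C)))
      (IsPathEmbedding-cancel {f = h′} {b} {m} m-isPE m≈bh′)
      b-isPE
      (C.trans (C.sym (Category.assoc C)) (C.trans (C.sym m≈sah) m≈bh′))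

module Cofree {o ℓ e : Level} {C : Category o ℓ e} (K : Comonad C) where
  open Category C
  open Comonad K
  open Coalgebra
  open CoalgHom
  open CategoryReasoning C
  open HomReasoning

  lift : (P : Coalgebra K) {Y : Obj} → carrier P ⇒ Y → CoalgHom K P (cofree K Y)
  lift P {Y} h = record
    { hom = W₁ h ∘ α P
    ; comm = begin
        W₁ (W₁ h ∘ α P) ∘ α P         ≈⟨ ∘-resp-≈ˡ homomorphism ⟩
        (W₁ (W₁ h) ∘ W₁ (α P)) ∘ α P  ≈⟨ assoc ⟩
        W₁ (W₁ h) ∘ (W₁ (α P) ∘ α P)  ≈⟨ ∘-resp-≈ʳ (coassoc P) ⟨
        W₁ (W₁ h) ∘ (δ _ ∘ α P)       ≈⟨ assoc ⟨
        (W₁ (W₁ h) ∘ δ _) ∘ α P       ≈⟨ ∘-resp-≈ˡ (δ-natural h) ⟨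
        (δ Y ∘ W₁ h) ∘ α P            ≈⟨ assoc ⟩
        δ Y ∘ (W₁ h ∘ α P)            ∎
    }

  ε∘lift : (P : Coalgebra K) {Y : Obj} (h : carrier P ⇒ Y) → ε Y ∘ hom (lift P h) ≈ h
  ε∘lift P {Y} h = begin
    ε Y ∘ (W₁ h ∘ α P)  ≈⟨ assoc ⟨
    (ε Y ∘ W₁ h) ∘ α P  ≈⟨ ∘-resp-≈ˡ (ε-natural h) ⟩
    (h ∘ ε _) ∘ α P     ≈⟨ assoc ⟩
    h ∘ (ε _ ∘ α P)     ≈⟨ ∘-resp-≈ʳ (counit P) ⟩
    h ∘ id              ≈⟨ identityʳ ⟩
    h                   ∎

  lift-ε∘ : ∀ {P Y} (k : CoalgHom K P (cofree K Y)) → hom (lift P (ε Y ∘ hom k)) ≈ hom k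
  lift-ε∘ {P} {Y} k = begin
    W₁ (ε Y ∘ hom k) ∘ α P          ≈⟨ ∘-resp-≈ˡ homomorphism ⟩
    (W₁ (ε Y) ∘ W₁ (hom k)) ∘ α P   ≈⟨ assoc ⟩
    W₁ (ε Y) ∘ (W₁ (hom k) ∘ α P)   ≈⟨ ∘-resp-≈ʳ (comm k) ⟩
    W₁ (ε Y) ∘ (δ Y ∘ hom k)        ≈⟨ assoc ⟨
    (W₁ (ε Y) ∘ δ Y) ∘ hom k        ≈⟨ ∘-resp-≈ˡ (identityʳ-law Y) ⟩
    id ∘ hom k                      ≈⟨ identityˡ ⟩
    hom k                           ∎

  lift-resp-≈ : (P : Coalgebra K) {Y : Obj} {h h′ : carrier P ⇒ Y} →
                h ≈ h′ → hom (lift P h) ≈ hom (lift P h′)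
  lift-resp-≈ P h≈h′ = ∘-resp-≈ˡ (F-resp-≈ h≈h′)

  lift-∘ˡ : (P : Coalgebra K) {X Y : Obj} (f : X ⇒ Y) (h : carrier P ⇒ X) →
            hom (lift P (f ∘ h)) ≈ W₁ f ∘ hom (lift P h)
  lift-∘ˡ P f h = trans (∘-resp-≈ˡ homomorphism) assoc

  lift-∘ʳ : ∀ {P Q : Coalgebra K} {Y} (h : carrier Q ⇒ Y) (k : CoalgHom K P Q) →
            hom (lift Q h) ∘ hom k ≈ hom (lift P (h ∘ hom k))
  lift-∘ʳ {P} {Q} h k = begin
    (W₁ h ∘ α Q) ∘ hom k           ≈⟨ assoc ⟩
    W₁ h ∘ (α Q ∘ hom k)           ≈⟨ ∘-resp-≈ʳ (comm k) ⟨
    W₁ h ∘ (W₁ (hom k) ∘ α P)      ≈⟨ lift-∘ˡ P h (hom k) ⟨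
    W₁ (h ∘ hom k) ∘ α P           ∎

  cofree-ext : ∀ {P Y} (k k′ : CoalgHom K P (cofree K Y)) →
               ε Y ∘ hom k ≈ ε Y ∘ hom k′ → hom k ≈ hom k′
  cofree-ext {P} k k′ εk≈εk′ =
    trans (sym (lift-ε∘ k)) (trans (lift-resp-≈ P εk≈εk′) (lift-ε∘ k′))

module Families {o ℓ e : Level} {n : ℕ} {C : Fin n → Category o ℓ e} (W : ∀ i → Comonad (C i)) where
  private
    module Π = Category (Πᶜ C)
    module W (i : Fin n) = Comonad (W i)

  ∣_∣ : (∀ i → Coalgebra (W i)) → Π.Obj
  ∣ Y ∣ i = Coalgebra.carrier (Y i)

  homs : ∀ {Y Y′ : ∀ i → Coalgebra (W i)} →
         (∀ i → CoalgHom (W i) (Y i) (Y′ i)) → ∣ Y ∣ Π.⇒ ∣ Y′ ∣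
  homs h i = CoalgHom.hom (h i)

  W₀s : Π.Obj → Π.Obj
  W₀s X i = W.W₀ i (X i)

  W₁s : ∀ {X Y} → X Π.⇒ Y → W₀s X Π.⇒ W₀s Y
  W₁s f i = W.W₁ i (f i)

  structures : (Y : ∀ i → Coalgebra (W i)) → ∣ Y ∣ Π.⇒ W₀s ∣ Y ∣
  structures Y i = Coalgebra.α (Y i)

  cofrees : Π.Obj → ∀ i → Coalgebra (W i)
  cofrees A i = cofree (W i) (A i)

  counits : (A : Π.Obj) → W₀s A Π.⇒ A
  counits A i = W.ε i (A i)

-- KleisliLaw lives in a parameter block of Defs that also binds a level p it never uses, so p
-- is fixed explicitly wherever a Kleisli law is a module parameter.
module Bimorphisms {o ℓ e p : Level} {n : ℕ} {C : Fin n → Category o ℓ e} {D : Category o ℓ e}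
  {H : Functor (Πᶜ C) D} {W : ∀ i → Comonad (C i)} {V : Comonad D}
  (KL : KleisliLaw {p = p} H W V) where
  open Category D
  open CategoryReasoning D
  open HomReasoning
  open Functor H
  open KleisliLaw KL
  open Families W
  open Cofree V
  open Coalgebra
  open CoalgHom
  private
    module V = Comonad V
    module W (i : Fin n) = Comonad (W i)
    module Π = Category (Πᶜ C)
    IsBim : (P : Coalgebra V) (A : ∀ i → Coalgebra (W i)) → carrier P ⇒ F₀ ∣ A ∣ → Set e
    IsBim = IsBimorphism H W V KL

  IsBimorphism-resp-≈ : ∀ {P Y} {b b′ : carrier P ⇒ F₀ ∣ Y ∣} →
                        b ≈ b′ → IsBim P Y b → IsBim P Y b′
  IsBimorphism-resp-≈ {P} {Y} {b} {b′} b≈b′ b-bim = begin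
    F₁ (structures Y) ∘ b′       ≈⟨ ∘-resp-≈ʳ b≈b′ ⟨
    F₁ (structures Y) ∘ b        ≈⟨ b-bim ⟩
    κ ∣ Y ∣ ∘ hom (lift P b)     ≈⟨ ∘-resp-≈ʳ (lift-resp-≈ P b≈b′) ⟩
    κ ∣ Y ∣ ∘ hom (lift P b′)    ∎

  IsBimorphism-∘ʳ : ∀ {P Q Y} {b : carrier Q ⇒ F₀ ∣ Y ∣} →
                    IsBim Q Y b → (k : CoalgHom V P Q) → IsBim P Y (b ∘ hom k)
  IsBimorphism-∘ʳ {P} {Q} {Y} {b} b-bim k = begin
    F₁ (structures Y) ∘ (b ∘ hom k)     ≈⟨ assoc ⟨
    (F₁ (structures Y) ∘ b) ∘ hom k     ≈⟨ ∘-resp-≈ˡ b-bim ⟩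
    (κ ∣ Y ∣ ∘ hom (lift Q b)) ∘ hom k  ≈⟨ assoc ⟩
    κ ∣ Y ∣ ∘ (hom (lift Q b) ∘ hom k)  ≈⟨ ∘-resp-≈ʳ (lift-∘ʳ b k) ⟩
    κ ∣ Y ∣ ∘ hom (lift P (b ∘ hom k))  ∎

  module _ (P : Coalgebra V) {Y Y′ : ∀ i → Coalgebra (W i)}
           (h : ∀ i → CoalgHom (W i) (Y i) (Y′ i)) (b : carrier P ⇒ F₀ ∣ Y ∣) where

    structures-natural : F₁ (W₁s (homs h)) ∘ (F₁ (structures Y) ∘ b) ≈
                     F₁ (structures Y′) ∘ (F₁ (homs h) ∘ b)
    structures-natural = begin
      F₁ (W₁s (homs h)) ∘ (F₁ (structures Y) ∘ b)  ≈⟨ assoc ⟨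
      (F₁ (W₁s (homs h)) ∘ F₁ (structures Y)) ∘ b  ≈⟨ ∘-resp-≈ˡ homomorphism ⟨
      F₁ (W₁s (homs h) Π.∘ structures Y) ∘ b   ≈⟨ ∘-resp-≈ˡ (F-resp-≈ (λ i → comm (h i))) ⟩
      F₁ (structures Y′ Π.∘ homs h) ∘ b        ≈⟨ ∘-resp-≈ˡ homomorphism ⟩
      (F₁ (structures Y′) ∘ F₁ (homs h)) ∘ b   ≈⟨ assoc ⟩
      F₁ (structures Y′) ∘ (F₁ (homs h) ∘ b)   ∎

    κ∘lift-natural : κ ∣ Y′ ∣ ∘ hom (lift P (F₁ (homs h) ∘ b)) ≈
            F₁ (W₁s (homs h)) ∘ (κ ∣ Y ∣ ∘ hom (lift P b))
    κ∘lift-natural = begin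
      κ ∣ Y′ ∣ ∘ hom (lift P (F₁ (homs h) ∘ b))        ≈⟨ ∘-resp-≈ʳ (lift-∘ˡ P (F₁ (homs h)) b) ⟩
      κ ∣ Y′ ∣ ∘ (V.W₁ (F₁ (homs h)) ∘ hom (lift P b))  ≈⟨ assoc ⟨
      (κ ∣ Y′ ∣ ∘ V.W₁ (F₁ (homs h))) ∘ hom (lift P b)  ≈⟨ ∘-resp-≈ˡ (natural (homs h)) ⟩
      (F₁ (W₁s (homs h)) ∘ κ ∣ Y ∣) ∘ hom (lift P b)  ≈⟨ assoc ⟩
      F₁ (W₁s (homs h)) ∘ (κ ∣ Y ∣ ∘ hom (lift P b))  ∎

    IsBimorphism-F₁∘ : IsBim P Y b → IsBim P Y′ (F₁ (homs h) ∘ b)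
    IsBimorphism-F₁∘ b-bim =
      trans (sym structures-natural) (trans (∘-resp-≈ʳ b-bim) (sym κ∘lift-natural))

    IsBimorphism-F₁∘-cancel : ∀ {FC : ∀ i → FactorisationSystem (C i) p}
                                {FD : FactorisationSystem D p} →
      HPreservesEmbeddings H FC FD → (∀ i → PreservesEmbeddings (FC i) (W i)) →
      (∀ i → FactorisationSystem.Emb (FC i) (hom (h i))) →
      IsBim P Y′ (F₁ (homs h) ∘ b) → IsBim P Y b
    IsBimorphism-F₁∘-cancel {FD = FD} H-emb W-emb h∈M hb-bim =
      IsProperFactorisationSystem.M-mono (FactorisationSystem.isProperFactorisationSystem FD)
        (H-emb _ (λ i → W-emb i _ (h∈M i))) _ _
        (trans structures-natural (trans hb-bim κ∘lift-natural))

  IsBimorphism-cofrees⇒≈κ∘lift : ∀ {P A} {b : carrier P ⇒ F₀ ∣ cofrees A ∣} →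
                                 IsBim P (cofrees A) b → b ≈ κ A ∘ hom (lift P (F₁ (counits A) ∘ b))
  IsBimorphism-cofrees⇒≈κ∘lift {P} {A} {b} b-bim = begin
    b                                                        ≈⟨ identityˡ ⟨
    id ∘ b                                                   ≈⟨ ∘-resp-≈ˡ identity ⟨
    F₁ Π.id ∘ b
      ≈⟨ ∘-resp-≈ˡ (F-resp-≈ (λ i → W.identityʳ-law i (A i))) ⟨
    F₁ (W₁s (counits A) Π.∘ structures (cofrees A)) ∘ b      ≈⟨ ∘-resp-≈ˡ homomorphism ⟩
    (F₁ (W₁s (counits A)) ∘ F₁ (structures (cofrees A))) ∘ b ≈⟨ assoc ⟩
    F₁ (W₁s (counits A)) ∘ (F₁ (structures (cofrees A)) ∘ b) ≈⟨ ∘-resp-≈ʳ b-bim ⟩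
    F₁ (W₁s (counits A)) ∘ (κ _ ∘ hom (lift P b))            ≈⟨ assoc ⟨
    (F₁ (W₁s (counits A)) ∘ κ _) ∘ hom (lift P b)            ≈⟨ ∘-resp-≈ˡ (natural (counits A)) ⟨
    (κ A ∘ V.W₁ (F₁ (counits A))) ∘ hom (lift P b)           ≈⟨ assoc ⟩
    κ A ∘ (V.W₁ (F₁ (counits A)) ∘ hom (lift P b))
      ≈⟨ ∘-resp-≈ʳ (lift-∘ˡ P (F₁ (counits A)) b) ⟨
    κ A ∘ hom (lift P (F₁ (counits A) ∘ b))                  ∎

  κ∘-isBimorphism : ∀ {Q A} (m : CoalgHom V Q (cofree V (F₀ A))) →
                    IsBim Q (cofrees A) (κ A ∘ hom m)
  κ∘-isBimorphism {Q} {A} m = begin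
    F₁ (structures (cofrees A)) ∘ (κ A ∘ hom m)  ≈⟨ assoc ⟨
    (F₁ (structures (cofrees A)) ∘ κ A) ∘ hom m  ≈⟨ ∘-resp-≈ˡ (K2 A) ⟩
    (κ _ ∘ (V.W₁ (κ A) ∘ V.δ _)) ∘ hom m         ≈⟨ assoc ⟩
    κ _ ∘ ((V.W₁ (κ A) ∘ V.δ _) ∘ hom m)         ≈⟨ ∘-resp-≈ʳ assoc ⟩
    κ _ ∘ (V.W₁ (κ A) ∘ (V.δ _ ∘ hom m))         ≈⟨ ∘-resp-≈ʳ (∘-resp-≈ʳ (comm m)) ⟨
    κ _ ∘ (V.W₁ (κ A) ∘ hom (lift Q (hom m)))    ≈⟨ ∘-resp-≈ʳ (lift-∘ˡ Q (κ A) (hom m)) ⟨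
    κ _ ∘ hom (lift Q (κ A ∘ hom m))             ∎

  κ∘-cancel : ∀ {Q A} (m m′ : CoalgHom V Q (cofree V (F₀ A))) →
              κ A ∘ hom m ≈ κ A ∘ hom m′ → hom m ≈ hom m′
  κ∘-cancel {A = A} m m′ κm≈κm′ = cofree-ext m m′ (begin
    V.ε _ ∘ hom m                    ≈⟨ ∘-resp-≈ˡ (K1 A) ⟨
    (F₁ (counits A) ∘ κ A) ∘ hom m   ≈⟨ assoc ⟩
    F₁ (counits A) ∘ (κ A ∘ hom m)   ≈⟨ ∘-resp-≈ʳ κm≈κm′ ⟩
    F₁ (counits A) ∘ (κ A ∘ hom m′)  ≈⟨ assoc ⟨
    (F₁ (counits A) ∘ κ A) ∘ hom m′  ≈⟨ ∘-resp-≈ˡ (K1 A) ⟩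
    V.ε _ ∘ hom m′                   ∎)

module Decompositions {o ℓ e p : Level} {n : ℕ} {C : Fin n → Category o ℓ e} {D : Category o ℓ e}
  {FC : ∀ i → FactorisationSystem (C i) p} {FD : FactorisationSystem D p}
  {W : ∀ i → Comonad (C i)} {V : Comonad D} {H : Functor (Πᶜ C) D}
  (W-emb : ∀ i → PreservesEmbeddings (FC i) (W i)) (V-emb : PreservesEmbeddings FD V)
  (H-emb : HPreservesEmbeddings H FC FD) (KL : KleisliLaw {p = p} H W V)
  (PC : ∀ i → EMPathCategory (W i) (FC i)) where
  open Category D
  open CategoryReasoning D
  open HomReasoning
  open Functor H
  open Families W
  open Bimorphisms KL
  open Cofree V
  open Coalgebra
  open CoalgHom
  open Decomposition
  open IsProperFactorisationSystem (FactorisationSystem.isProperFactorisationSystem FD)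
  open FactorisationProperties D (FactorisationSystem.isProperFactorisationSystem FD)
  private
    module V = Comonad V
    Dec : (P : Coalgebra V) (A : ∀ i → Coalgebra (W i)) → carrier P ⇒ F₀ ∣ A ∣ →
          Set (o ⊔ ℓ ⊔ e ⊔ p)
    Dec = Decomposition H W V KL FC PC
    IsBim : (P : Coalgebra V) (A : ∀ i → Coalgebra (W i)) → carrier P ⇒ F₀ ∣ A ∣ → Set e
    IsBim = IsBimorphism H W V KL
    module Π = Category (Πᶜ C)
    module EMᵢ (i : Fin n) = Category (EM (W i))
    module PEᵢ (i : Fin n) = PathEmbeddingProperties (PC i)

  Decomposition-resp-≈ : ∀ {P A} {f f′ : carrier P ⇒ F₀ ∣ A ∣} →
                         f ≈ f′ → Dec P A f → Dec P A f′
  Decomposition-resp-≈ f≈f′ d = record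
    { Pᵢ = Pᵢ d
    ; emb = emb d
    ; emb-isPathEmbedding = emb-isPathEmbedding d
    ; f₀ = f₀ d
    ; factorisation = trans (sym f≈f′) (factorisation d)
    }

  Decomposition-∘ʳ : ∀ {P Q A} {f : carrier Q ⇒ F₀ ∣ A ∣} →
                     Dec Q A f → (k : CoalgHom V P Q) → Dec P A (f ∘ hom k)
  Decomposition-∘ʳ d k = record
    { Pᵢ = Pᵢ d
    ; emb = emb d
    ; emb-isPathEmbedding = emb-isPathEmbedding d
    ; f₀ = f₀ d ∘ hom k
    ; factorisation = trans (∘-resp-≈ˡ (factorisation d)) assoc
    }

  Decomposition-F₁∘ : ∀ {P Z Y} {f : carrier P ⇒ F₀ ∣ Z ∣}
                      (s : ∀ i → CoalgHom (W i) (Z i) (Y i)) →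
                      (∀ i → IsPathwiseEmbedding (PC i) (s i)) →
                      Dec P Z f → Dec P Y (F₁ (homs s) ∘ f)
  Decomposition-F₁∘ {f = f} s s-isPathwise d = record
    { Pᵢ = Pᵢ d
    ; emb = λ i → EMᵢ._∘_ i (s i) (emb d i)
    ; emb-isPathEmbedding = λ i →
        proj₁ (emb-isPathEmbedding d i) , s-isPathwise i (emb d i) (emb-isPathEmbedding d i)
    ; f₀ = f₀ d
    ; factorisation = begin
        F₁ (homs s) ∘ f                               ≈⟨ ∘-resp-≈ʳ (factorisation d) ⟩
        F₁ (homs s) ∘ (F₁ (homs (emb d)) ∘ f₀ d)      ≈⟨ assoc ⟨
        (F₁ (homs s) ∘ F₁ (homs (emb d))) ∘ f₀ d      ≈⟨ ∘-resp-≈ˡ homomorphism ⟨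
        F₁ (homs s Π.∘ homs (emb d)) ∘ f₀ d           ∎
    }

  f₀-comparison : ∀ {P A f} (d d′ : Dec P A f) (h : ∀ i → CoalgHom (W i) (Pᵢ d i) (Pᵢ d′ i)) →
                  (∀ i → EMᵢ._≈_ i (emb d i) (EMᵢ._∘_ i (emb d′ i) (h i))) →
                  f₀ d′ ≈ F₁ (homs h) ∘ f₀ d
  f₀-comparison {f = f} d d′ h d≈d′h =
    M-mono (H-emb _ (λ i → proj₂ (emb-isPathEmbedding d′ i))) _ _ (begin
        F₁ (homs (emb d′)) ∘ f₀ d′                  ≈⟨ factorisation d′ ⟨
        f                                           ≈⟨ factorisation d ⟩
        F₁ (homs (emb d)) ∘ f₀ d                    ≈⟨ ∘-resp-≈ˡ (F-resp-≈ d≈d′h) ⟩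
        F₁ (homs (emb d′) Π.∘ homs h) ∘ f₀ d        ≈⟨ ∘-resp-≈ˡ homomorphism ⟩
        (F₁ (homs (emb d′)) ∘ F₁ (homs h)) ∘ f₀ d   ≈⟨ assoc ⟩
        F₁ (homs (emb d′)) ∘ (F₁ (homs h) ∘ f₀ d)   ∎)

  f₀-isBimorphism : ∀ {P A f} → IsBim P A f → (d : Dec P A f) → IsBim P (Pᵢ d) (f₀ d)
  f₀-isBimorphism {P} {A} f-bim d =
    IsBimorphism-F₁∘-cancel P (emb d) (f₀ d) {FC = FC} {FD} H-emb W-emb
      (λ i → proj₂ (emb-isPathEmbedding d i))
      (IsBimorphism-resp-≈ {P} {A} (factorisation d) f-bim)

  lift-factorisation : ∀ {P A f} (d : Dec P A f) →
                       hom (lift P f) ≈ V.W₁ (F₁ (homs (emb d))) ∘ hom (lift P (f₀ d))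
  lift-factorisation {P} d = trans (lift-resp-≈ P (factorisation d)) (lift-∘ˡ P _ (f₀ d))

  lift-f₀-isEmbedding : ∀ {P A f} (d : Dec P A f) →
    FactorisationSystem.Emb FD (hom (lift P f)) → FactorisationSystem.Emb FD (hom (lift P (f₀ d)))
  lift-f₀-isEmbedding d lift∈M = M-cancel (M-resp-≈ (lift-factorisation d) lift∈M)

  lift-isEmbedding : ∀ {P A f} (d : Dec P A f) →
    FactorisationSystem.Emb FD (hom (lift P (f₀ d))) → FactorisationSystem.Emb FD (hom (lift P f))
  lift-isEmbedding d lift-f₀∈M = M-resp-≈ (sym (lift-factorisation d))
    (M-comp lift-f₀∈M (V-emb _ (H-emb _ (λ i → proj₂ (emb-isPathEmbedding d i)))))

  module _ {PD : EMPathCategory V FD} (S2 : AxiomS2′ H W V KL FC PC FD PD)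
           {Z Y : ∀ i → Coalgebra (W i)} (s : ∀ i → CoalgHom (W i) (Z i) (Y i))
           (s-isOPE : ∀ i → IsOpenPathwiseEmbedding (PC i) (s i)) where

    decomposition-reflect : ∀ {P} → EMPathCategory.IsPath PD P →
      {f : carrier P ⇒ F₀ ∣ Z ∣} → IsBim P Z f → (d : Dec P Y (F₁ (homs s) ∘ f)) →
      Σ[ r ∈ (∀ i → CoalgHom (W i) (Pᵢ d i) (Z i)) ]
        ((∀ i → EMᵢ._≈_ i (emb d i) (EMᵢ._∘_ i (s i) (r i))) × (f ≈ F₁ (homs r) ∘ f₀ d))
    decomposition-reflect {P} P-isPath {f} f-bim d =
      r , (λ i → proj₂ (proj₂ (filler i))) , f≈rf₀
      where
      dZ : Dec P Z f
      dZ = proj₁ (S2 P P-isPath Z f f-bim)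
      sdZ : Dec P Y (F₁ (homs s) ∘ f)
      sdZ = Decomposition-F₁∘ s (λ i → proj₂ (s-isOPE i)) dZ
      dM : Dec P Y (F₁ (homs s) ∘ f)
      dM = proj₁ (S2 P P-isPath Y (F₁ (homs s) ∘ f) (IsBimorphism-F₁∘ P s f f-bim))
      dM-isMinimal : IsMinimalDecomposition H W V KL FC PC dM
      dM-isMinimal = proj₂ (S2 P P-isPath Y (F₁ (homs s) ∘ f) (IsBimorphism-F₁∘ P s f f-bim))
      h : ∀ i → CoalgHom (W i) (Pᵢ dM i) (Pᵢ dZ i)
      h = proj₁ (dM-isMinimal sdZ)
      h′ : ∀ i → CoalgHom (W i) (Pᵢ dM i) (Pᵢ d i)
      h′ = proj₁ (dM-isMinimal d)
      filler : ∀ i → Σ[ r ∈ CoalgHom (W i) (Pᵢ d i) (Z i) ]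
                   (EMᵢ._≈_ i (EMᵢ._∘_ i (emb dZ i) (h i)) (EMᵢ._∘_ i r (h′ i)) ×
                    EMᵢ._≈_ i (emb d i) (EMᵢ._∘_ i (s i) r))
      filler i = PEᵢ.IsOpen-diagonal i {s = s i} {emb dZ i} {emb d i} {h i} {h′ i} {emb dM i}
                   (proj₁ (s-isOPE i)) (emb-isPathEmbedding dM i)
                     (emb-isPathEmbedding d i) (proj₂ (dM-isMinimal sdZ) i) (proj₂ (dM-isMinimal d) i)
      r : ∀ i → CoalgHom (W i) (Pᵢ d i) (Z i)
      r i = proj₁ (filler i)
      f≈rf₀ : f ≈ F₁ (homs r) ∘ f₀ d
      f≈rf₀ = begin
        f                                               ≈⟨ factorisation dZ ⟩
        F₁ (homs (emb dZ)) ∘ f₀ dZ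
          ≈⟨ ∘-resp-≈ʳ (f₀-comparison dM sdZ h (proj₂ (dM-isMinimal sdZ))) ⟩
        F₁ (homs (emb dZ)) ∘ (F₁ (homs h) ∘ f₀ dM)      ≈⟨ assoc ⟨
        (F₁ (homs (emb dZ)) ∘ F₁ (homs h)) ∘ f₀ dM      ≈⟨ ∘-resp-≈ˡ homomorphism ⟨
        F₁ (homs (emb dZ) Π.∘ homs h) ∘ f₀ dM
          ≈⟨ ∘-resp-≈ˡ (F-resp-≈ (λ i → proj₁ (proj₂ (filler i)))) ⟩
        F₁ (homs r Π.∘ homs h′) ∘ f₀ dM                 ≈⟨ ∘-resp-≈ˡ homomorphism ⟩
        (F₁ (homs r) ∘ F₁ (homs h′)) ∘ f₀ dM            ≈⟨ assoc ⟩
        F₁ (homs r) ∘ (F₁ (homs h′) ∘ f₀ dM)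
          ≈⟨ ∘-resp-≈ʳ (f₀-comparison dM d h′ (proj₂ (dM-isMinimal d))) ⟨
        F₁ (homs r) ∘ f₀ d                              ∎

module BimorphismClassifiers {o ℓ e p : Level} {n : ℕ} {C : Fin n → Category o ℓ e} {D : Category o ℓ e}
  {W : ∀ i → Comonad (C i)} {V : Comonad D} {H : Functor (Πᶜ C) D}
  (KL : KleisliLaw {p = p} H W V) (FD : FactorisationSystem D p) where
  open Category D
  open CategoryReasoning D
  open HomReasoning
  open Functor H
  open KleisliLaw KL
  open Families W
  open Bimorphisms KL
  open Cofree V
  open Coalgebra
  open CoalgHom
  open IsProperFactorisationSystem (FactorisationSystem.isProperFactorisationSystem FD)
  private
    module V = Comonad V
    IsBim : (P : Coalgebra V) (A : ∀ i → Coalgebra (W i)) → carrier P ⇒ F₀ ∣ A ∣ → Set e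
    IsBim = IsBimorphism H W V KL

  record BimorphismClassifier (Z : ∀ i → Coalgebra (W i)) : Set (o ⊔ ℓ ⊔ e ⊔ p) where
    field
      obj : Coalgebra V
      π : carrier obj ⇒ F₀ ∣ Z ∣
      π-isBimorphism : IsBim obj Z π
      lift-π-isEmbedding : FactorisationSystem.Emb FD (hom (lift obj π))
      classify : ∀ {P} (c : carrier P ⇒ F₀ ∣ Z ∣) → IsBim P Z c →
                 Σ[ u ∈ CoalgHom V P obj ] (π ∘ hom u ≈ c)

    π∘-isBimorphism : ∀ {P} (u : CoalgHom V P obj) → IsBim P Z (π ∘ hom u)
    π∘-isBimorphism = IsBimorphism-∘ʳ {Q = obj} {Z} π-isBimorphism

    π∘-cancel : ∀ {P} (u u′ : CoalgHom V P obj) →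
                π ∘ hom u ≈ π ∘ hom u′ → hom u ≈ hom u′
    π∘-cancel {P} u u′ πu≈πu′ = M-mono lift-π-isEmbedding (hom u) (hom u′) (begin
      hom (lift obj π) ∘ hom u    ≈⟨ lift-∘ʳ π u ⟩
      hom (lift P (π ∘ hom u))    ≈⟨ lift-resp-≈ P πu≈πu′ ⟩
      hom (lift P (π ∘ hom u′))   ≈⟨ lift-∘ʳ π u′ ⟨
      hom (lift obj π) ∘ hom u′   ∎)

  module _ (PD : EMPathCategory V FD) (eqD : HasEqualisers (EM V)) where

    equaliserClassifier : (Z : ∀ i → Coalgebra (W i)) → BimorphismClassifier Z
    equaliserClassifier Z = record
      { obj = obj
      ; π = V.ε _ ∘ hom arr
      ; π-isBimorphism = equalises⇒isBimorphism arr equality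
      ; lift-π-isEmbedding = M-resp-≈ (sym (lift-ε∘ arr))
          (FactorisationProperties.equaliser-M (EM V) (EMPathCategory.liftedIsProper PD) (eqD u v))
      ; classify = λ {P} c c-bim →
          let (w , arr∘w≈liftc) = universal (lift P c) (isBimorphism⇒equalises (lift P c)
                                    (IsBimorphism-resp-≈ {P} {Z} (sym (ε∘lift P c)) c-bim))
          in w , (begin
            (V.ε _ ∘ hom arr) ∘ hom w  ≈⟨ assoc ⟩
            V.ε _ ∘ (hom arr ∘ hom w)  ≈⟨ ∘-resp-≈ʳ arr∘w≈liftc ⟩
            V.ε _ ∘ hom (lift P c)     ≈⟨ ε∘lift P c ⟩
            c                          ∎)
      }
      where
      HZ : Obj
      HZ = F₀ ∣ Z ∣
      u v : CoalgHom V (cofree V HZ) (cofree V (F₀ (W₀s ∣ Z ∣)))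
      u = lift (cofree V HZ) (F₁ (structures Z) ∘ V.ε HZ)
      v = lift (cofree V HZ) (κ ∣ Z ∣)
      open Equaliser (eqD u v)

      ε∘u∘ : ∀ {P} (k : CoalgHom V P (cofree V HZ)) →
             V.ε _ ∘ (hom u ∘ hom k) ≈ F₁ (structures Z) ∘ (V.ε HZ ∘ hom k)
      ε∘u∘ k = begin
        V.ε _ ∘ (hom u ∘ hom k)                ≈⟨ assoc ⟨
        (V.ε _ ∘ hom u) ∘ hom k                ≈⟨ ∘-resp-≈ˡ (ε∘lift (cofree V HZ) _) ⟩
        (F₁ (structures Z) ∘ V.ε HZ) ∘ hom k   ≈⟨ assoc ⟩
        F₁ (structures Z) ∘ (V.ε HZ ∘ hom k)   ∎

      ε∘v∘ : ∀ {P} (k : CoalgHom V P (cofree V HZ)) →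
             V.ε _ ∘ (hom v ∘ hom k) ≈ κ ∣ Z ∣ ∘ hom (lift P (V.ε HZ ∘ hom k))
      ε∘v∘ {P} k = begin
        V.ε _ ∘ (hom v ∘ hom k)                 ≈⟨ assoc ⟨
        (V.ε _ ∘ hom v) ∘ hom k                 ≈⟨ ∘-resp-≈ˡ (ε∘lift (cofree V HZ) _) ⟩
        κ ∣ Z ∣ ∘ hom k                         ≈⟨ ∘-resp-≈ʳ (lift-ε∘ k) ⟨
        κ ∣ Z ∣ ∘ hom (lift P (V.ε HZ ∘ hom k))  ∎

      equalises⇒isBimorphism : ∀ {P} (k : CoalgHom V P (cofree V HZ)) →
        hom u ∘ hom k ≈ hom v ∘ hom k → IsBim P Z (V.ε HZ ∘ hom k)
      equalises⇒isBimorphism k uk≈vk =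
        trans (sym (ε∘u∘ k)) (trans (∘-resp-≈ʳ uk≈vk) (ε∘v∘ k))

      isBimorphism⇒equalises : ∀ {P} (k : CoalgHom V P (cofree V HZ)) →
        IsBim P Z (V.ε HZ ∘ hom k) → hom u ∘ hom k ≈ hom v ∘ hom k
      isBimorphism⇒equalises k εk-bim =
        cofree-ext (Category._∘_ (EM V) u k) (Category._∘_ (EM V) v k)
          (trans (ε∘u∘ k) (trans εk-bim (sym (ε∘v∘ k))))

module InducedMap {o ℓ e p : Level} {n : ℕ} {C : Fin n → Category o ℓ e} {D : Category o ℓ e}
  {FC : ∀ i → FactorisationSystem (C i) p} {FD : FactorisationSystem D p}
  {W : ∀ i → Comonad (C i)} {V : Comonad D} {H : Functor (Πᶜ C) D}
  (W-emb : ∀ i → PreservesEmbeddings (FC i) (W i)) (V-emb : PreservesEmbeddings FD V)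
  (H-emb : HPreservesEmbeddings H FC FD) (KL : KleisliLaw {p = p} H W V)
  (PC : ∀ i → EMPathCategory (W i) (FC i)) (PD : EMPathCategory V FD)
  (S2 : AxiomS2′ H W V KL FC PC FD PD)
  {Z : ∀ i → Coalgebra (W i)} (𝒦 : BimorphismClassifiers.BimorphismClassifier KL FD Z)
  (A : Category.Obj (Πᶜ C)) (s : ∀ i → CoalgHom (W i) (Z i) (cofree (W i) (A i)))
  (s-isOPE : ∀ i → IsOpenPathwiseEmbedding (PC i) (s i)) where
  open Category D
  open CategoryReasoning D
  open HomReasoning
  open Functor H
  open KleisliLaw KL
  open Families W
  open Bimorphisms KL
  open Decompositions {FD = FD} W-emb V-emb H-emb KL PC
  open Cofree V
  open Coalgebra
  open CoalgHom
  open Decomposition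
  open IsProperFactorisationSystem (FactorisationSystem.isProperFactorisationSystem FD)
  open FactorisationProperties D (FactorisationSystem.isProperFactorisationSystem FD)
  open BimorphismClassifiers.BimorphismClassifier 𝒦
  private
    module V = Comonad V
    module Π = Category (Πᶜ C)
    module EMᵥ = Category (EM V)
    module EMᵢ (i : Fin n) = Category (EM (W i))
    Dec : (P : Coalgebra V) (A : ∀ i → Coalgebra (W i)) → carrier P ⇒ F₀ ∣ A ∣ →
          Set (o ⊔ ℓ ⊔ e ⊔ p)
    Dec = Decomposition H W V KL FC PC

  inducedMap : CoalgHom V obj (cofree V (F₀ A))
  inducedMap = lift obj (F₁ (counits A Π.∘ homs s) ∘ π)

  F₁s∘π∘≈κ∘inducedMap∘ : ∀ {P} (u : CoalgHom V P obj) →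
                         F₁ (homs s) ∘ (π ∘ hom u) ≈ κ A ∘ (hom inducedMap ∘ hom u)
  F₁s∘π∘≈κ∘inducedMap∘ {P} u = begin
    F₁ (homs s) ∘ (π ∘ hom u)
      ≈⟨ IsBimorphism-cofrees⇒≈κ∘lift {P} {A}
           (IsBimorphism-F₁∘ P s (π ∘ hom u) (π∘-isBimorphism u)) ⟩
    κ A ∘ hom (lift P (F₁ (counits A) ∘ (F₁ (homs s) ∘ (π ∘ hom u))))
      ≈⟨ ∘-resp-≈ʳ (lift-resp-≈ P (begin
           F₁ (counits A) ∘ (F₁ (homs s) ∘ (π ∘ hom u))  ≈⟨ assoc ⟨
           (F₁ (counits A) ∘ F₁ (homs s)) ∘ (π ∘ hom u)  ≈⟨ ∘-resp-≈ˡ homomorphism ⟨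
           F₁ (counits A Π.∘ homs s) ∘ (π ∘ hom u)       ≈⟨ assoc ⟨
           (F₁ (counits A Π.∘ homs s) ∘ π) ∘ hom u       ∎)) ⟩
    κ A ∘ hom (lift P ((F₁ (counits A Π.∘ homs s) ∘ π) ∘ hom u))
      ≈⟨ ∘-resp-≈ʳ (lift-∘ʳ _ u) ⟨
    κ A ∘ (hom inducedMap ∘ hom u)  ∎

  inducedMap-isPathwiseEmbedding : IsPathwiseEmbedding PD inducedMap
  inducedMap-isPathwiseEmbedding {P} e (P-isPath , e∈M) =
    M-cancel (M-cancel (M-resp-≈ lift-F₁s∘π∘e≈ (lift-isEmbedding sd lift-f₀∈M)))
    where
    d : Dec P Z (π ∘ hom e)
    d = proj₁ (S2 P P-isPath Z (π ∘ hom e) (π∘-isBimorphism e))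
    sd : Dec P (cofrees A) (F₁ (homs s) ∘ (π ∘ hom e))
    sd = Decomposition-F₁∘ s (λ i → proj₂ (s-isOPE i)) d
    lift-f₀∈M : FactorisationSystem.Emb FD (hom (lift P (f₀ d)))
    lift-f₀∈M = lift-f₀-isEmbedding d (M-resp-≈ (lift-∘ʳ π e) (M-comp e∈M lift-π-isEmbedding))
    lift-F₁s∘π∘e≈ : hom (lift P (F₁ (homs s) ∘ (π ∘ hom e))) ≈
                    V.W₁ (κ A) ∘ (V.δ _ ∘ (hom inducedMap ∘ hom e))
    lift-F₁s∘π∘e≈ = begin
      hom (lift P (F₁ (homs s) ∘ (π ∘ hom e)))
        ≈⟨ lift-resp-≈ P (F₁s∘π∘≈κ∘inducedMap∘ e) ⟩
      hom (lift P (κ A ∘ (hom inducedMap ∘ hom e)))       ≈⟨ lift-∘ˡ P (κ A) _ ⟩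
      V.W₁ (κ A) ∘ hom (lift P (hom inducedMap ∘ hom e))  ≈⟨ ∘-resp-≈ʳ (comm (inducedMap EMᵥ.∘ e)) ⟩
      V.W₁ (κ A) ∘ (V.δ _ ∘ (hom inducedMap ∘ hom e))     ∎

  inducedMap-isOpen : IsOpen PD inducedMap
  inducedMap-isOpen {P} {Q} e g m (P-isPath , _) _ (Q-isPath , _) square =
    w , e≈wg , m≈inducedMap∘w
    where
    κm-bim : IsBimorphism H W V KL Q (cofrees A) (κ A ∘ hom m)
    κm-bim = κ∘-isBimorphism m
    dQ : Dec Q (cofrees A) (κ A ∘ hom m)
    dQ = proj₁ (S2 Q Q-isPath (cofrees A) (κ A ∘ hom m) κm-bim)
    F₁s∘π∘e≈κ∘m∘g : F₁ (homs s) ∘ (π ∘ hom e) ≈ (κ A ∘ hom m) ∘ hom g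
    F₁s∘π∘e≈κ∘m∘g =
      trans (F₁s∘π∘≈κ∘inducedMap∘ e) (trans (∘-resp-≈ʳ square) (sym assoc))
    reflected : Σ[ r ∈ (∀ i → CoalgHom (W i) (Pᵢ dQ i) (Z i)) ]
                  ((∀ i → EMᵢ._≈_ i (emb dQ i) (EMᵢ._∘_ i (s i) (r i))) ×
                   (π ∘ hom e ≈ F₁ (homs r) ∘ (f₀ dQ ∘ hom g)))
    reflected =
      decomposition-reflect {PD = PD} S2 s s-isOPE P-isPath {π ∘ hom e} (π∘-isBimorphism e)
        (Decomposition-resp-≈ (sym F₁s∘π∘e≈κ∘m∘g) (Decomposition-∘ʳ dQ g))
    r : ∀ i → CoalgHom (W i) (Pᵢ dQ i) (Z i)
    r = proj₁ reflected
    c : carrier Q ⇒ F₀ ∣ Z ∣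
    c = F₁ (homs r) ∘ f₀ dQ
    classified : Σ[ w ∈ CoalgHom V Q obj ] (π ∘ hom w ≈ c)
    classified = classify c (IsBimorphism-F₁∘ Q r (f₀ dQ) (f₀-isBimorphism κm-bim dQ))
    w : CoalgHom V Q obj
    w = proj₁ classified
    π∘w≈c : π ∘ hom w ≈ c
    π∘w≈c = proj₂ classified
    e≈wg : hom e ≈ hom w ∘ hom g
    e≈wg = π∘-cancel e (w EMᵥ.∘ g) (begin
      π ∘ hom e                      ≈⟨ proj₂ (proj₂ reflected) ⟩
      F₁ (homs r) ∘ (f₀ dQ ∘ hom g)  ≈⟨ assoc ⟨
      c ∘ hom g                      ≈⟨ ∘-resp-≈ˡ π∘w≈c ⟨
      (π ∘ hom w) ∘ hom g            ≈⟨ assoc ⟩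
      π ∘ (hom w ∘ hom g)            ∎)
    m≈inducedMap∘w : hom m ≈ hom inducedMap ∘ hom w
    m≈inducedMap∘w = κ∘-cancel m (inducedMap EMᵥ.∘ w) (begin
      κ A ∘ hom m                          ≈⟨ factorisation dQ ⟩
      F₁ (homs (emb dQ)) ∘ f₀ dQ           ≈⟨ ∘-resp-≈ˡ (F-resp-≈ (proj₁ (proj₂ reflected))) ⟩
      F₁ (homs s Π.∘ homs r) ∘ f₀ dQ       ≈⟨ ∘-resp-≈ˡ homomorphism ⟩
      (F₁ (homs s) ∘ F₁ (homs r)) ∘ f₀ dQ  ≈⟨ assoc ⟩
      F₁ (homs s) ∘ c                      ≈⟨ ∘-resp-≈ʳ π∘w≈c ⟨
      F₁ (homs s) ∘ (π ∘ hom w)            ≈⟨ F₁s∘π∘≈κ∘inducedMap∘ w ⟩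
      κ A ∘ (hom inducedMap ∘ hom w)       ∎)

  inducedMap-isOpenPathwiseEmbedding : IsOpenPathwiseEmbedding PD inducedMap
  inducedMap-isOpenPathwiseEmbedding = inducedMap-isOpen , inducedMap-isPathwiseEmbedding

theorem6p9 : ∀ {o ℓ e p : Level} {n : ℕ}
    (C : Fin n → Category o ℓ e) (D : Category o ℓ e)
    (FC : ∀ i → FactorisationSystem (C i) p) (FD : FactorisationSystem D p)
    (W : ∀ i → Comonad (C i)) (V : Comonad D)
    (W-emb : ∀ i → PreservesEmbeddings (FC i) (W i)) (V-emb : PreservesEmbeddings FD V)
    (PC : ∀ i → EMPathCategory (W i) (FC i)) (PD : EMPathCategory V FD)
    (eqD : HasEqualisers (EM V))
    (H : Functor (Πᶜ C) D)
    (H-emb : HPreservesEmbeddings H FC FD)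
    (KL : KleisliLaw H W V)
    (S2 : AxiomS2′ H W V KL FC PC FD PD)
    (A B : ∀ i → Category.Obj (C i)) →
    (∀ i → _≡ₖ_ (PC i) (A i) (B i)) →
    _≡ₖ_ PD (Functor.F₀ H A) (Functor.F₀ H B)
theorem6p9 C D FC FD W V W-emb V-emb PC PD eqD H H-emb KL S2 A B A≡B =
  obj , ToA.inducedMap , ToB.inducedMap ,
  ToA.inducedMap-isOpenPathwiseEmbedding , ToB.inducedMap-isOpenPathwiseEmbedding
  where
  open BimorphismClassifiers KL FD
  Z : ∀ i → Coalgebra (W i)
  Z i = proj₁ (A≡B i)
  𝒦 : BimorphismClassifier Z
  𝒦 = equaliserClassifier PD eqD Z
  open BimorphismClassifier 𝒦 using (obj)
  s : ∀ i → CoalgHom (W i) (Z i) (cofree (W i) (A i))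
  s i = proj₁ (proj₂ (A≡B i))
  t : ∀ i → CoalgHom (W i) (Z i) (cofree (W i) (B i))
  t i = proj₁ (proj₂ (proj₂ (A≡B i)))
  module ToA = InducedMap W-emb V-emb H-emb KL PC PD S2 𝒦 A s
    (λ i → proj₁ (proj₂ (proj₂ (proj₂ (A≡B i)))))
  module ToB = InducedMap W-emb V-emb H-emb KL PC PD S2 𝒦 B t
    (λ i → proj₂ (proj₂ (proj₂ (proj₂ (A≡B i)))))
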